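{- Let $\Gamma$ be a bipartite $(d,3,-4)$-graph such that $\Gamma_1$ has exactly one connected component $G$, $G$ is isomorphic to $\Phi_{d^2-d-1}$ (with vertices labelled $x_0,\dots,x_{m-1},y_0,\dots,y_{m-1}$, $m=d^2-d-1$, as in the definition of $\Phi_m$), and $V(G)$ spans $\Gamma$. If the vertex $x_0$ has neighbors $y_0,y_1,y_{ -1},y_{i_1},y_{i_2},\dots,y_{i_{d-3}}$ in $G$, then for every $k$ the vertex $x_k$ has neighbors $y_k,y_{k+1},y_{k-1},y_{k+i_1},y_{k+i_2},\dots,y_{k+i_{d-3}}$ (subscripts modulo $d^2-d-1$).
   Context: All graphs are simple. The bipartite Moore bound is $\mathcal{M}^b(d,D)=2(1+(d-1)+\dots+(d-1)^{D-1})$; a bipartite $(d,D,-\epsilon)$-graph is a bipartite graph of maximum degree $d$, diameter $D$ and order $\mathcal{M}^b(d,D)-\epsilon$. In a bipartite $(d,3,-4)$-graph $\Gamma$, a short cycle is a cycle of length at most $4$; two distinct short cycles are neighbors if they share a vertex. $S_1(\Gamma)$ is the set of short cycles whose intersections with their neighbor cycles are paths of length $1$, and $\Gamma_1$ is the subgraph formed by the union of all cycles in $S_1(\Gamma)$. For $m\ge5$, $\Phi_m$ is the bipartite graph with vertex set $\{x_0,\dots,x_{m-1}\}\cup\{y_0,\dots,y_{m-1}\}$ and edges $x_i\sim y_i$, $x_i\sim y_{i+1}$, $x_i\sim y_{i-1}$ for $0\le i\le m-1$, subscripts modulo $m$. -}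

module Defs where

open import Data.Nat using (ℕ; zero; suc; _+_; _*_; _∸_; _^_; _≤_)
open import Data.Fin using (Fin; toℕ; inject₁; fromℕ) renaming (zero to fzero; suc to fsuc)
open import Data.Bool using (Bool; true; false; if_then_else_)
open import Data.List using (List; map; allFin)
open import Data.Nat.ListAction using (sum)
open import Data.Sum using (_⊎_; inj₁; inj₂)
open import Data.Product using (Σ; ∃; _×_; _,_)
open import Data.Empty using (⊥)
open import Relation.Nullary using (¬_)
open import Relation.Binary.PropositionalEquality using (_≡_; _≢_)
open import Function.Definitions using (Injective)
open import Function.Bundles using (_⇔_; _⤖_)

record Graph : Set where
  field
    n      : ℕ
    adj    : Fin n → Fin n → Bool
    sym    : ∀ u v → adj u v ≡ adj v u
    irrefl : ∀ v → adj v v ≡ false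

module _ (Γ : Graph) where
  open Graph Γ

  Adj : Fin n → Fin n → Set
  Adj u v = adj u v ≡ true

  degree : Fin n → ℕ
  degree v = sum (map (λ u → if adj v u then 1 else 0) (allFin n))

  MaxDegree : ℕ → Set
  MaxDegree d = (∀ v → degree v ≤ d) × ∃ λ v → degree v ≡ d

  data WalkIn (R : Fin n → Fin n → Set) : Fin n → Fin n → ℕ → Set where
    nil  : ∀ {u} → WalkIn R u u 0
    cons : ∀ {u w v k} → R u w → WalkIn R w v k → WalkIn R u v (suc k)

  Walk : Fin n → Fin n → ℕ → Set
  Walk = WalkIn Adj

  Diameter : ℕ → Set
  Diameter D = (∀ u v → ∃ λ k → k ≤ D × Walk u v k)
             × ∃ λ u → ∃ λ v → ∀ k → Walk u v k → D ≤ k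

  Bipartite : Set
  Bipartite = ∃ λ (c : Fin n → Bool) → ∀ u v → Adj u v → c u ≢ c v

  -- Short cycles: cycles of length 3 or 4, i.e. length 3 + j with j ≤ 1.
  -- Vertices vs 0, …, vs (2+j) in cyclic order, pairwise distinct.

  record ShortCycle : Set where
    field
      j      : ℕ
      j≤1    : j ≤ 1
      vs     : Fin (suc (suc (suc j))) → Fin n
      inj    : Injective _≡_ _≡_ vs
      steps  : ∀ (i : Fin (suc (suc j))) → Adj (vs (inject₁ i)) (vs (fsuc i))
      close  : Adj (vs (fromℕ (suc (suc j)))) (vs fzero)

  InCycle : ShortCycle → Fin n → Set
  InCycle C v = ∃ λ i → ShortCycle.vs C i ≡ v

  EdgeOf : ShortCycle → Fin n → Fin n → Set
  EdgeOf C u v =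
      (∃ λ (i : Fin (suc (suc j))) →
          (vs (inject₁ i) ≡ u × vs (fsuc i) ≡ v) ⊎ (vs (inject₁ i) ≡ v × vs (fsuc i) ≡ u))
    ⊎ ((vs (fromℕ (suc (suc j))) ≡ u × vs fzero ≡ v) ⊎ (vs (fromℕ (suc (suc j))) ≡ v × vs fzero ≡ u))
    where open ShortCycle C

  SameCycle : ShortCycle → ShortCycle → Set
  SameCycle C C' = ∀ u v → EdgeOf C u v ⇔ EdgeOf C' u v

  Neighbors : ShortCycle → ShortCycle → Set
  Neighbors C C' = ¬ SameCycle C C' × ∃ λ v → InCycle C v × InCycle C' v

  IntersectionIsP1 : ShortCycle → ShortCycle → Set
  IntersectionIsP1 C C' = ∃ λ u → ∃ λ v → u ≢ v
    × (∀ w → (InCycle C w × InCycle C' w) ⇔ (w ≡ u ⊎ w ≡ v))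
    × EdgeOf C u v × EdgeOf C' u v

  InS₁ : ShortCycle → Set
  InS₁ C = ∀ C' → Neighbors C C' → IntersectionIsP1 C C'

  VΓ₁ : Fin n → Set
  VΓ₁ v = ∃ λ C → InS₁ C × InCycle C v

  EΓ₁ : Fin n → Fin n → Set
  EΓ₁ u v = ∃ λ C → InS₁ C × EdgeOf C u v

-- Bipartite Moore bound  M^b(d,D) = 2 (1 + (d-1) + … + (d-1)^(D-1))

geomSum : ℕ → ℕ → ℕ
geomSum d zero    = 0
geomSum d (suc D) = geomSum d D + (d ∸ 1) ^ D

MooreB : ℕ → ℕ → ℕ
MooreB d D = 2 * geomSum d D

BipartiteDDε : Graph → ℕ → ℕ → ℕ → Set
BipartiteDDε Γ d D ε =
  Bipartite Γ × MaxDegree Γ d × Diameter Γ D × Graph.n Γ + ε ≡ MooreB d D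

_≡_[mod_] : ℕ → ℕ → ℕ → Set
a ≡ b [mod m ] = ∃ λ q → (a ≡ b + q * m) ⊎ (b ≡ a + q * m)

-- The graph Φ_m on {x_i} ⊎ {y_i}: x_i ∼ y_i, x_i ∼ y_{i+1}, x_i ∼ y_{i-1} (mod m)
PhiXY : (m : ℕ) → Fin m → Fin m → Set
PhiXY m i j = (toℕ j ≡ toℕ i [mod m ])
            ⊎ (toℕ j ≡ suc (toℕ i) [mod m ])
            ⊎ (suc (toℕ j) ≡ toℕ i [mod m ])

PhiAdj : (m : ℕ) → Fin m ⊎ Fin m → Fin m ⊎ Fin m → Set
PhiAdj m (inj₁ i) (inj₂ j) = PhiXY m i j
PhiAdj m (inj₂ j) (inj₁ i) = PhiXY m i j
PhiAdj m (inj₁ _) (inj₁ _) = ⊥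
PhiAdj m (inj₂ _) (inj₂ _) = ⊥

NbrPattern : (m d : ℕ) → (Fin (d ∸ 3) → ℕ) → ℕ → Fin m → Set
NbrPattern m d offs c j = (toℕ j ≡ c [mod m ])
                        ⊎ (toℕ j ≡ suc c [mod m ])
                        ⊎ (suc (toℕ j) ≡ c [mod m ])
                        ⊎ (∃ λ t → toℕ j ≡ c + offs t [mod m ])

module Submission where

-- Write B x y for "x_x ∼ y_y", indices read modulo m.  As Φ_m ⊆ Γ, B contains
-- the diagonal and the two neighbouring diagonals; degrees are at most d; and
-- diameter 3 in a bipartite graph makes any two rows (columns) of B share a
-- column (row).  Counting common neighbours against the degree bound, with
-- m + 1 = d (d - 1), shows that every row has exactly d entries and that rows
-- x ≠ k share exactly 1 + [k = x ± 1] columns: BBᵀ = BᵀB = J + P + P⁻¹ + (d-1)I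
-- for the cyclic shift P (CyclicIncidence.Counting).  Counting walks of length
-- 3 in two ways gives B (P + P⁻¹) = (P + P⁻¹) B, and a local "no staircase"
-- argument upgrades this to BP = PB (CyclicIncidence.Shifts).  Hence row k of B
-- is row 0 shifted by k (FromGraph.Neighbourhoods).

open import Defs
open import Data.Nat using (ℕ; _*_; _∸_; _≤_)
open import Data.Fin using (Fin; toℕ)
open import Data.Sum using (_⊎_; inj₁; inj₂)
open import Data.Product using (∃; _×_)
open import Relation.Binary.PropositionalEquality using (_≡_)
open import Function.Bundles using (_⇔_; _⤖_; Bijection)

open import Data.Nat using (zero; suc; _+_; _<_; _≟_; _≤?_; _%_; _/_; NonZero; z≤n; s≤s; s≤s⁻¹)
open import Data.Nat.Properties
open import Data.Nat.DivMod
open import Data.Nat.ListAction using (sum)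
open import Data.Nat.Tactic.RingSolver using (solve-∀)
import Data.Fin as Fin
import Data.Fin.Properties as Fin
open import Data.Bool using (Bool; true; false; if_then_else_)
open import Data.Bool.Properties using (¬-not)
open import Data.List using (tabulate)
open import Data.List.Properties using (map-tabulate)
open import Data.Product using (_,_; proj₁; proj₂; map₂)
open import Data.Sum.Properties using (inj₁-injective; inj₂-injective)
open import Data.Sum.Function.Propositional using (_⊎-⇔_)
open import Data.Empty using (⊥; ⊥-elim)
open import Function.Base using (_∘_; id)
open import Function.Bundles using (Equivalence; mk⇔)
import Function.Properties.Equivalence as ⇔
open import Level using (0ℓ)
open import Relation.Nullary using (¬_; yes; no; does)
open import Relation.Binary.Bundles using (Setoid)
open import Relation.Binary.PropositionalEquality
  using (_≢_; refl; sym; trans; cong; cong₂; subst; module ≡-Reasoning)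
import Relation.Binary.Reasoning.Setoid as SetoidReasoning

module FiniteSums where

  Σ< : ℕ → (ℕ → ℕ) → ℕ
  Σ< zero    f = 0
  Σ< (suc n) f = Σ< n f + f n

  below-last : ∀ {i n} → i < suc n → i ≢ n → i < n
  below-last i<1+n i≢n = ≤∧≢⇒< (s≤s⁻¹ i<1+n) i≢n

  Σ<-cong : ∀ n {f g : ℕ → ℕ} → (∀ i → i < n → f i ≡ g i) → Σ< n f ≡ Σ< n g
  Σ<-cong zero    eq = refl
  Σ<-cong (suc n) eq = cong₂ _+_ (Σ<-cong n (λ i i<n → eq i (m<n⇒m<1+n i<n))) (eq n ≤-refl)

  Σ<-mono : ∀ n {f g : ℕ → ℕ} → (∀ i → i < n → f i ≤ g i) → Σ< n f ≤ Σ< n g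
  Σ<-mono zero    le = z≤n
  Σ<-mono (suc n) le = +-mono-≤ (Σ<-mono n (λ i i<n → le i (m<n⇒m<1+n i<n))) (le n ≤-refl)

  Σ<-+ : ∀ n (f g : ℕ → ℕ) → Σ< n (λ i → f i + g i) ≡ Σ< n f + Σ< n g
  Σ<-+ zero    f g = refl
  Σ<-+ (suc n) f g rewrite Σ<-+ n f g = +-exchange (Σ< n f) (Σ< n g) (f n) (g n)
    where
    +-exchange : ∀ a b c e → a + b + (c + e) ≡ a + c + (b + e)
    +-exchange = solve-∀

  Σ<-*ˡ : ∀ n c (f : ℕ → ℕ) → Σ< n (λ i → c * f i) ≡ c * Σ< n f
  Σ<-*ˡ zero    c f = sym (*-zeroʳ c)
  Σ<-*ˡ (suc n) c f rewrite Σ<-*ˡ n c f = sym (*-distribˡ-+ c (Σ< n f) (f n))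

  Σ<-zero : ∀ n → Σ< n (λ _ → 0) ≡ 0
  Σ<-zero zero    = refl
  Σ<-zero (suc n) = cong (_+ 0) (Σ<-zero n)

  Σ<-swap : ∀ n k (f : ℕ → ℕ → ℕ) →
            Σ< n (λ i → Σ< k (f i)) ≡ Σ< k (λ j → Σ< n (λ i → f i j))
  Σ<-swap zero    k f = sym (Σ<-zero k)
  Σ<-swap (suc n) k f rewrite Σ<-swap n k f =
    sym (Σ<-+ k (λ j → Σ< n (λ i → f i j)) (f n))

  Σ<-count : ∀ n → Σ< n (λ _ → 1) ≡ n
  Σ<-count zero    = refl
  Σ<-count (suc n) = trans (cong (_+ 1) (Σ<-count n)) (+-comm n 1)

  δ : ℕ → ℕ → ℕ
  δ c i with c ≟ i
  ... | yes _ = 1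
  ... | no  _ = 0

  δ-same : ∀ c → δ c c ≡ 1
  δ-same c with c ≟ c
  ... | yes _   = refl
  ... | no  c≢c = ⊥-elim (c≢c refl)

  δ-diff : ∀ {c i} → c ≢ i → δ c i ≡ 0
  δ-diff {c} {i} c≢i with c ≟ i
  ... | yes c≡i = ⊥-elim (c≢i c≡i)
  ... | no  _   = refl

  δ-cong : ∀ {c i c' i'} → (c ≡ i → c' ≡ i') → (c' ≡ i' → c ≡ i) → δ c i ≡ δ c' i'
  δ-cong {c} {i} {c'} {i'} to from with c ≟ i | c' ≟ i'
  ... | yes _   | yes _    = refl
  ... | no  _   | no  _    = refl
  ... | yes c≡i | no  c'≢i' = ⊥-elim (c'≢i' (to c≡i))
  ... | no  c≢i | yes c'≡i' = ⊥-elim (c≢i (from c'≡i'))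

  Σ<-sift : ∀ n c (f : ℕ → ℕ) → c < n → Σ< n (λ i → δ c i * f i) ≡ f c
  Σ<-sift (suc n) c f c<1+n with c ≟ n
  ... | yes refl = trans (cong (_+ (f c + 0)) (outside n ≤-refl)) (+-identityʳ (f c))
    where
    outside : ∀ k → k ≤ c → Σ< k (λ i → δ c i * f i) ≡ 0
    outside zero    _   = refl
    outside (suc k) k<c rewrite outside k (<⇒≤ k<c) | δ-diff (>⇒≢ k<c) = refl
  ... | no  c≢n = trans (cong (_+ 0) (Σ<-sift n c f (below-last c<1+n c≢n))) (+-identityʳ (f c))

  Σ<-weighted : ∀ n (f : ℕ → ℕ) a c₁ c₂ c₃ → c₁ < n → c₂ < n → c₃ < n →
                Σ< n (λ z → f z * (1 + δ c₁ z + δ c₂ z + a * δ c₃ z))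
                  ≡ Σ< n f + f c₁ + f c₂ + a * f c₃
  Σ<-weighted n f a c₁ c₂ c₃ c₁<n c₂<n c₃<n = begin
    Σ< n (λ z → f z * (1 + δ c₁ z + δ c₂ z + a * δ c₃ z))
      ≡⟨ Σ<-cong n (λ z _ → distribute (f z) (δ c₁ z) (δ c₂ z) (δ c₃ z) a) ⟩
    Σ< n (λ z → f z + δ c₁ z * f z + δ c₂ z * f z + a * (δ c₃ z * f z))
      ≡⟨ Σ<-+ n _ _ ⟩
    Σ< n (λ z → f z + δ c₁ z * f z + δ c₂ z * f z) + Σ< n (λ z → a * (δ c₃ z * f z))
      ≡⟨ cong₂ _+_ (Σ<-+ n _ _) (Σ<-*ˡ n a _) ⟩
    Σ< n (λ z → f z + δ c₁ z * f z) + Σ< n (λ z → δ c₂ z * f z) + a * Σ< n (λ z → δ c₃ z * f z)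
      ≡⟨ cong (λ s → s + Σ< n (λ z → δ c₂ z * f z) + a * Σ< n (λ z → δ c₃ z * f z)) (Σ<-+ n _ _) ⟩
    Σ< n f + Σ< n (λ z → δ c₁ z * f z) + Σ< n (λ z → δ c₂ z * f z) + a * Σ< n (λ z → δ c₃ z * f z)
      ≡⟨ cong₂ (λ s t → Σ< n f + s + t + a * Σ< n (λ z → δ c₃ z * f z))
               (Σ<-sift n c₁ f c₁<n) (Σ<-sift n c₂ f c₂<n) ⟩
    Σ< n f + f c₁ + f c₂ + a * Σ< n (λ z → δ c₃ z * f z)
      ≡⟨ cong (λ s → Σ< n f + f c₁ + f c₂ + a * s) (Σ<-sift n c₃ f c₃<n) ⟩
    Σ< n f + f c₁ + f c₂ + a * f c₃ ∎
    where
    open ≡-Reasoning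
    distribute : ∀ x p q r a → x * (1 + p + q + a * r) ≡ x + p * x + q * x + a * (r * x)
    distribute = solve-∀

  term≤Σ< : ∀ n (f : ℕ → ℕ) i → i < n → f i ≤ Σ< n f
  term≤Σ< (suc n) f i i<1+n with i ≟ n
  ... | yes refl = m≤n+m (f i) (Σ< n f)
  ... | no  i≢n  = ≤-trans (term≤Σ< n f i (below-last i<1+n i≢n)) (m≤m+n (Σ< n f) (f n))

  twoTerms≤Σ< : ∀ n (f : ℕ → ℕ) i j → i < n → j < n → i ≢ j → f i + f j ≤ Σ< n f
  twoTerms≤Σ< (suc n) f i j i<1+n j<1+n i≢j with i ≟ n | j ≟ n
  ... | yes refl | yes refl = ⊥-elim (i≢j refl)
  ... | yes refl | no  j≢n  = ≤-trans (≤-reflexive (+-comm (f i) (f j)))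
                                      (+-monoˡ-≤ (f i) (term≤Σ< n f j (below-last j<1+n j≢n)))
  ... | no  i≢n  | yes refl = +-monoˡ-≤ (f j) (term≤Σ< n f i (below-last i<1+n i≢n))
  ... | no  i≢n  | no  j≢n  =
    ≤-trans (twoTerms≤Σ< n f i j (below-last i<1+n i≢n) (below-last j<1+n j≢n) i≢j)
            (m≤m+n (Σ< n f) (f n))

  +-tight : ∀ {a b c e} → c ≤ a → e ≤ b → a + b ≡ c + e → a ≡ c × b ≡ e
  +-tight {a} {b} {c} {e} c≤a e≤b eq = ≤-antisym a≤c c≤a , ≤-antisym b≤e e≤b
    where
    a≤c : a ≤ c
    a≤c = +-cancelʳ-≤ b a c (≤-trans (≤-reflexive eq) (+-monoʳ-≤ c e≤b))
    b≤e : b ≤ e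
    b≤e = +-cancelˡ-≤ a b e (≤-trans (≤-reflexive eq) (+-monoˡ-≤ e c≤a))

  Σ<-tight : ∀ n (f g : ℕ → ℕ) → (∀ i → i < n → f i ≤ g i) → Σ< n g ≡ Σ< n f →
             ∀ i → i < n → g i ≡ f i
  Σ<-tight (suc n) f g f≤g sums-eq = tight
    where
    f≤g-prefix : ∀ j → j < n → f j ≤ g j
    f≤g-prefix j j<n = f≤g j (m<n⇒m<1+n j<n)

    split : Σ< n g ≡ Σ< n f × g n ≡ f n
    split = +-tight (Σ<-mono n f≤g-prefix) (f≤g n ≤-refl) sums-eq

    tight : ∀ i → i < suc n → g i ≡ f i
    tight i i<1+n with i ≟ n
    ... | yes refl = proj₂ split
    ... | no  i≢n  = Σ<-tight n f g f≤g-prefix (proj₁ split) i (below-last i<1+n i≢n)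

bit : Bool → ℕ
bit b = if b then 1 else 0

two-colours : ∀ {a b c : Bool} → a ≢ b → c ≢ b → a ≡ c
two-colours a≢b c≢b = trans (¬-not a≢b) (sym (¬-not c≢b))

bit-sum : ∀ {u v s t} → bit u + bit v ≡ bit s + bit t → s ≡ true ⊎ t ≡ true → u ≡ true ⊎ v ≡ true
bit-sum {true}          _  _ = inj₁ refl
bit-sum {false} {true}  _  _ = inj₂ refl
bit-sum {false} {false} {true}         () (inj₁ refl)
bit-sum {false} {false} {false} {true} () (inj₂ refl)

module Congruence (m : ℕ) .{{_ : NonZero m}} where

  -- a ≈ b: a and b leave the same remainder modulo m.  (A record rather
  -- than a definition, so that a and b are recoverable from the type.)
  infix 4 _≈_
  record _≈_ (a b : ℕ) : Set where
    constructor mk≈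
    field rem≡ : a % m ≡ b % m

  ≈-refl : ∀ {a} → a ≈ a
  ≈-refl = mk≈ refl

  ≈-reflexive : ∀ {a b} → a ≡ b → a ≈ b
  ≈-reflexive refl = ≈-refl

  ≈-sym : ∀ {a b} → a ≈ b → b ≈ a
  ≈-sym (mk≈ eq) = mk≈ (sym eq)

  ≈-trans : ∀ {a b c} → a ≈ b → b ≈ c → a ≈ c
  ≈-trans (mk≈ eq₁) (mk≈ eq₂) = mk≈ (trans eq₁ eq₂)

  ≈-setoid : Setoid 0ℓ 0ℓ
  ≈-setoid = record
    { Carrier       = ℕ
    ; _≈_           = _≈_
    ; isEquivalence = record { refl = ≈-refl ; sym = ≈-sym ; trans = ≈-trans }
    }

  module ≈-Reasoning = SetoidReasoning ≈-setoid

  %-≈ : ∀ a → a % m ≈ a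
  %-≈ a = mk≈ (m%n%n≡m%n a m)

  +m-≈ : ∀ a → a + m ≈ a
  +m-≈ a = mk≈ ([m+n]%n≡m%n a m)

  ≈⇒≡ : ∀ {a b} → a < m → b < m → a ≈ b → a ≡ b
  ≈⇒≡ a<m b<m (mk≈ eq) = trans (sym (m<n⇒m%n≡m a<m)) (trans eq (m<n⇒m%n≡m b<m))

  ≈-+ : ∀ {a b c e} → a ≈ b → c ≈ e → a + c ≈ b + e
  ≈-+ {a} {b} {c} {e} (mk≈ a≈b) (mk≈ c≈e) = mk≈ (begin
    (a + c) % m           ≡⟨ %-distribˡ-+ a c m ⟩
    (a % m + c % m) % m   ≡⟨ cong₂ (λ x y → (x + y) % m) a≈b c≈e ⟩
    (b % m + e % m) % m   ≡⟨ %-distribˡ-+ b e m ⟨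
    (b + e) % m           ∎)
    where open ≡-Reasoning

  +-inverse : ∀ s → s + (m ∸ s % m) ≈ 0
  +-inverse s = mk≈ (begin
    (s + (m ∸ s % m)) % m                   ≡⟨ cong (λ x → (x + (m ∸ s % m)) % m) (m≡m%n+[m/n]*n s m) ⟩
    (s % m + s / m * m + (m ∸ s % m)) % m   ≡⟨ cong (_% m) (regroup (s % m) (s / m * m) (m ∸ s % m)) ⟩
    (s / m * m + (s % m + (m ∸ s % m))) % m ≡⟨ cong (λ x → (s / m * m + x) % m) (m+[n∸m]≡n (m%n≤n s m)) ⟩
    (s / m * m + m) % m                     ≡⟨ [m+n]%n≡m%n (s / m * m) m ⟩
    (0 + s / m * m) % m                     ≡⟨ [m+kn]%n≡m%n 0 (s / m) m ⟩
    0 % m                                   ∎)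
    where
    open ≡-Reasoning
    regroup : ∀ x y z → x + y + z ≡ y + (x + z)
    regroup = solve-∀

  ≈-cancelʳ : ∀ {a b} s → a + s ≈ b + s → a ≈ b
  ≈-cancelʳ {a} {b} s a+s≈b+s = begin
    a                       ≡⟨ +-identityʳ a ⟨
    a + 0                   ≈⟨ ≈-+ (≈-refl {a}) (+-inverse s) ⟨
    a + (s + (m ∸ s % m))   ≡⟨ +-assoc a s _ ⟨
    a + s + (m ∸ s % m)     ≈⟨ ≈-+ a+s≈b+s ≈-refl ⟩
    b + s + (m ∸ s % m)     ≡⟨ +-assoc b s _ ⟩
    b + (s + (m ∸ s % m))   ≈⟨ ≈-+ (≈-refl {b}) (+-inverse s) ⟩
    b + 0                   ≡⟨ +-identityʳ b ⟩
    b                       ∎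
    where open ≈-Reasoning

  [mod]⇔≈ : ∀ {a b} → a ≡ b [mod m ] ⇔ a ≈ b
  [mod]⇔≈ {a} {b} = mk⇔ to from
    where
    to : a ≡ b [mod m ] → a ≈ b
    to (q , inj₁ refl) = mk≈ ([m+kn]%n≡m%n b q m)
    to (q , inj₂ refl) = mk≈ (sym ([m+kn]%n≡m%n a q m))

    exceeds : ∀ {x y} → x ≈ y → y / m ≤ x / m → x ≡ y + (x / m ∸ y / m) * m
    exceeds {x} {y} (mk≈ x≈y) y/m≤x/m = begin
      x                                       ≡⟨ m≡m%n+[m/n]*n x m ⟩
      x % m + x / m * m                       ≡⟨ cong₂ (λ r q → r + q * m) x≈y (sym (m+[n∸m]≡n y/m≤x/m)) ⟩
      y % m + (y / m + (x / m ∸ y / m)) * m   ≡⟨ expand (y % m) (y / m) (x / m ∸ y / m) m ⟩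
      y % m + y / m * m + (x / m ∸ y / m) * m ≡⟨ cong (_+ (x / m ∸ y / m) * m) (m≡m%n+[m/n]*n y m) ⟨
      y + (x / m ∸ y / m) * m                 ∎
      where
      open ≡-Reasoning
      expand : ∀ r p q n → r + (p + q) * n ≡ r + p * n + q * n
      expand = solve-∀

    from : a ≈ b → a ≡ b [mod m ]
    from a≈b with ≤-total (b / m) (a / m)
    ... | inj₁ b/m≤a/m = a / m ∸ b / m , inj₁ (exceeds a≈b b/m≤a/m)
    ... | inj₂ a/m≤b/m = b / m ∸ a / m , inj₂ (exceeds (≈-sym a≈b) a/m≤b/m)

  translate : ∀ {a b a' b'} s → a' ≈ a + s → b' ≈ b + s →
              a ≡ b [mod m ] ⇔ a' ≡ b' [mod m ]
  translate s a'≈a+s b'≈b+s = mk⇔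
    (λ a≡b → Equivalence.from [mod]⇔≈
       (≈-trans a'≈a+s (≈-trans (≈-+ (Equivalence.to [mod]⇔≈ a≡b) ≈-refl) (≈-sym b'≈b+s))))
    (λ a'≡b' → Equivalence.from [mod]⇔≈
       (≈-cancelʳ s (≈-trans (≈-sym a'≈a+s) (≈-trans (Equivalence.to [mod]⇔≈ a'≡b') b'≈b+s))))

module PatternTranslation (m d : ℕ) .{{_ : NonZero m}} (offs : Fin (d ∸ 3) → ℕ) where

  open Congruence m

  NbrPattern-translate : ∀ {c} {j j' : Fin m} s → toℕ j' ≈ toℕ j + s →
                         NbrPattern m d offs c j ⇔ NbrPattern m d offs (c + s) j'
  NbrPattern-translate {c} {j} {j'} s j'≈j+s =
    translate s j'≈j+s ≈-refl ⊎-⇔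
    translate s j'≈j+s ≈-refl ⊎-⇔
    translate s (≈-+ (≈-refl {1}) j'≈j+s) ≈-refl ⊎-⇔
    mk⇔ (map₂ λ {t} → Equivalence.to (at t)) (map₂ λ {t} → Equivalence.from (at t))
    where
    right-comm : ∀ a b e → a + b + e ≡ a + e + b
    right-comm = solve-∀

    at : ∀ t → toℕ j ≡ c + offs t [mod m ] ⇔ toℕ j' ≡ c + s + offs t [mod m ]
    at t = translate s j'≈j+s (≈-reflexive (right-comm c s (offs t)))

-- Sums over Fin n.  Pulling a sum back along an injection from [0, k)
-- can only decrease it; this bounds row sums by vertex degrees.

module FinSums where

  open FiniteSums

  ΣFin : ∀ n → (Fin n → ℕ) → ℕ
  ΣFin n g = sum (tabulate g)

  degree≡ΣFin : ∀ Γ v → degree Γ v ≡ ΣFin (Graph.n Γ) (λ u → bit (Graph.adj Γ v u))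
  degree≡ΣFin Γ v = cong sum (map-tabulate id (λ u → bit (Graph.adj Γ v u)))

  without : ∀ {n} → Fin n → (Fin n → ℕ) → Fin n → ℕ
  without v g u = if does (u Fin.≟ v) then 0 else g u

  ΣFin-split : ∀ n (g : Fin n → ℕ) v → ΣFin n g ≡ g v + ΣFin n (without v g)
  ΣFin-split (suc n) g Fin.zero    = refl
  ΣFin-split (suc n) g (Fin.suc v) = begin
    g Fin.zero + ΣFin n (g ∘ Fin.suc)
      ≡⟨ cong (g Fin.zero +_) (ΣFin-split n (g ∘ Fin.suc) v) ⟩
    g Fin.zero + (g (Fin.suc v) + ΣFin n (without v (g ∘ Fin.suc)))
      ≡⟨ left-comm (g Fin.zero) (g (Fin.suc v)) _ ⟩
    g (Fin.suc v) + (g Fin.zero + ΣFin n (without v (g ∘ Fin.suc))) ∎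
    where
    open ≡-Reasoning
    left-comm : ∀ a b e → a + (b + e) ≡ b + (a + e)
    left-comm = solve-∀

  Σ<-injection≤ : ∀ {n} k (g : Fin n → ℕ) (ψ : ℕ → Fin n) →
                  (∀ a b → a < k → b < k → ψ a ≡ ψ b → a ≡ b) → Σ< k (g ∘ ψ) ≤ ΣFin n g
  Σ<-injection≤     zero    g ψ ψ-inj = z≤n
  Σ<-injection≤ {n} (suc k) g ψ ψ-inj = begin
    Σ< k (g ∘ ψ) + g (ψ k)             ≡⟨ cong (_+ g (ψ k)) (Σ<-cong k unaffected) ⟩
    Σ< k (g' ∘ ψ) + g (ψ k)            ≤⟨ +-monoˡ-≤ (g (ψ k)) (Σ<-injection≤ k g' ψ ψ-inj') ⟩
    ΣFin n g' + g (ψ k)                ≡⟨ +-comm (ΣFin n g') (g (ψ k)) ⟩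
    g (ψ k) + ΣFin n g'                ≡⟨ ΣFin-split n g (ψ k) ⟨
    ΣFin n g                           ∎
    where
    open ≤-Reasoning
    g' : Fin n → ℕ
    g' = without (ψ k) g

    ψ-inj' : ∀ a b → a < k → b < k → ψ a ≡ ψ b → a ≡ b
    ψ-inj' a b a<k b<k = ψ-inj a b (m<n⇒m<1+n a<k) (m<n⇒m<1+n b<k)

    unaffected : ∀ y → y < k → g (ψ y) ≡ g' (ψ y)
    unaffected y y<k with ψ y Fin.≟ ψ k
    ... | no  _  = refl
    ... | yes eq = ⊥-elim (<⇒≢ y<k (ψ-inj y k (m<n⇒m<1+n y<k) ≤-refl eq))

module BipartiteWalks (Γ : Graph) where

  Adj-sym : ∀ {u v} → Adj Γ u v → Adj Γ v u
  Adj-sym {u} {v} = trans (Graph.sym Γ v u)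

  walk≤3 : (col : Fin (Graph.n Γ) → Bool) → (∀ u v → Adj Γ u v → col u ≢ col v) →
           ∀ {u v k} → k ≤ 3 → Walk Γ u v k → col u ≡ col v →
           u ≡ v ⊎ ∃ λ w → Adj Γ u w × Adj Γ w v
  walk≤3 col proper _ nil _ = inj₁ refl
  walk≤3 col proper _ (cons e nil) same = ⊥-elim (proper _ _ e same)
  walk≤3 col proper _ (cons e₁ (cons e₂ nil)) _ = inj₂ (_ , e₁ , e₂)
  walk≤3 col proper _ (cons e₁ (cons e₂ (cons e₃ nil))) same =
    ⊥-elim (proper _ _ e₃ (trans (sym (two-colours (proper _ _ e₁) (proper _ _ e₂ ∘ sym))) same))
  walk≤3 col proper (s≤s (s≤s (s≤s ()))) (cons _ (cons _ (cons _ (cons _ _)))) _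

-- Cyclic incidence structures.  B x y says that x_x ∼ y_y; indices are
-- read modulo m = m₁ + 1, where m + 1 = d (d - 1) and d = d' + 1.

module CyclicIncidence (m₁ d' : ℕ) (m≥5 : 5 ≤ suc m₁) (m+1≡dd' : suc m₁ + 1 ≡ suc d' * d') where

  open FiniteSums

  m d : ℕ
  m = suc m₁
  d = suc d'

  open Congruence m public

  record IsIncidence (B : ℕ → ℕ → Bool) : Set where
    field
      B-cong   : ∀ {x x' y y'} → x ≈ x' → y ≈ y' → B x y ≡ B x' y'
      diagonal : ∀ x → B x x ≡ true
      upper    : ∀ x → B x (suc x) ≡ true
      lower    : ∀ x → B (suc x) x ≡ true
      rowSum≤  : ∀ x → x < m → Σ< m (λ y → bit (B x y)) ≤ d
      colSum≤  : ∀ y → y < m → Σ< m (λ x → bit (B x y)) ≤ d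
      rowsMeet : ∀ x k → x < m → k < m → x ≢ k →
                 ∃ λ y → y < m × B x y ≡ true × B k y ≡ true
      colsMeet : ∀ y l → y < m → l < m → y ≢ l →
                 ∃ λ x → x < m × B x y ≡ true × B x l ≡ true

  transpose : ∀ {B} → IsIncidence B → IsIncidence (λ x y → B y x)
  transpose I = record
    { B-cong   = λ x≈x' y≈y' → B-cong y≈y' x≈x'
    ; diagonal = diagonal
    ; upper    = lower
    ; lower    = upper
    ; rowSum≤  = colSum≤
    ; colSum≤  = rowSum≤
    ; rowsMeet = colsMeet
    ; colsMeet = rowsMeet
    }
    where open IsIncidence I

  1≤d' : 1 ≤ d'
  1≤d' = n≢0⇒n>0 (λ d'≡0 → 1+n≢0 (trans m+1≡dd' (cong (λ e → suc e * e) d'≡0)))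

  0<m : 0 < m
  1<m : 1 < m
  2<m : 2 < m
  3<m : 3 < m
  0<m = ≤-trans (s≤s z≤n) m≥5
  1<m = ≤-trans (s≤s (s≤s z≤n)) m≥5
  2<m = ≤-trans (s≤s (s≤s (s≤s z≤n))) m≥5
  3<m = ≤-trans (s≤s (s≤s (s≤s (s≤s z≤n)))) m≥5

  m₁<m : m₁ < m
  m₁<m = ≤-refl

  offsets-distinct : ∀ p s t → s < m → t < m → s ≢ t → ¬ (s + p ≈ t + p)
  offsets-distinct p s t s<m t<m s≢t s+p≈t+p = s≢t (≈⇒≡ s<m t<m (≈-cancelʳ p s+p≈t+p))

  -- The counting inequality m + 1 + r ≤ d r of a row with r ≤ d entries
  -- leaves no room: r = d (using m + 1 = d (d - 1) and d ≥ 2).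
  degree-forced : ∀ r → r ≤ d → m + 1 + r ≤ d * r → r ≡ d
  degree-forced r r≤d bound with r ≤? d'
  ... | no  r≰d' = ≤-antisym r≤d (≰⇒> r≰d')
  ... | yes r≤d' = ⊥-elim (<-irrefl refl (begin-strict
    m + 1 + r            ≤⟨ bound ⟩
    d * r                ≡⟨⟩
    r + d' * r           ≤⟨ +-monoʳ-≤ r (*-monoʳ-≤ d' r≤d') ⟩
    r + d' * d'          <⟨ m<n+m (r + d' * d') 1≤d' ⟩
    d' + (r + d' * d')   ≡⟨ regroup d' r ⟩
    d * d' + r           ≡⟨ cong (_+ r) m+1≡dd' ⟨
    m + 1 + r            ∎))
    where
    open ≤-Reasoning
    regroup : ∀ e r → e + (r + e * e) ≡ suc e * e + r
    regroup = solve-∀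

  -- The lower bound given by the
  -- pattern, summed over all rows, already exhausts the degree bound; hence
  -- every row has exactly d entries and the bound is attained.
  module Counting {B : ℕ → ℕ → Bool} (I : IsIncidence B) where

    open IsIncidence I

    b : ℕ → ℕ → ℕ
    b x y = bit (B x y)

    b-cong : ∀ {x x' y y'} → x ≈ x' → y ≈ y' → b x y ≡ b x' y'
    b-cong x≈x' y≈y' = cong bit (B-cong x≈x' y≈y')

    b-true : ∀ {x y} → B x y ≡ true → b x y ≡ 1
    b-true B≡true = cong bit B≡true

    b-idem : ∀ x y → b x y * b x y ≡ b x y
    b-idem x y with B x y
    ... | true  = refl
    ... | false = refl

    next prev : ℕ → ℕ
    next x = suc x % m
    prev x = (x + m₁) % m

    next<m : ∀ x → next x < m
    next<m x = m%n<n (suc x) m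

    prev<m : ∀ x → prev x < m
    prev<m x = m%n<n (x + m₁) m

    next-≈ : ∀ {x x'} → x ≈ x' → next x ≈ suc x'
    next-≈ {x} x≈x' = ≈-trans (%-≈ (suc x)) (≈-+ (≈-refl {1}) x≈x')

    suc-+m₁ : ∀ x → suc (x + m₁) ≈ x
    suc-+m₁ x = ≈-trans (≈-reflexive (sym (+-suc x m₁))) (+m-≈ x)

    prev-≈ : ∀ {x x'} → x ≈ suc x' → prev x ≈ x'
    prev-≈ {x} x≈1+x' = ≈-trans (%-≈ (x + m₁)) (≈-trans (≈-+ x≈1+x' ≈-refl) (suc-+m₁ _))

    next-row : ∀ x → B (next x) x ≡ true
    next-row x = trans (B-cong (next-≈ ≈-refl) ≈-refl) (lower x)

    next-col : ∀ x → B x (next x) ≡ true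
    next-col x = trans (B-cong ≈-refl (next-≈ ≈-refl)) (upper x)

    prev-row : ∀ x → B (prev x) x ≡ true
    prev-row x = trans (B-cong (%-≈ (x + m₁)) (≈-sym (suc-+m₁ x))) (upper (x + m₁))

    prev-col : ∀ x → B x (prev x) ≡ true
    prev-col x = trans (B-cong (≈-sym (suc-+m₁ x)) (%-≈ (x + m₁))) (lower (x + m₁))

    prev-≈m₁ : ∀ x → prev x ≈ m₁ + x
    prev-≈m₁ x = ≈-trans (%-≈ (x + m₁)) (≈-reflexive (+-comm x m₁))

    next≢self : ∀ x → next x ≢ x
    next≢self x eq = offsets-distinct x 1 0 1<m 0<m (λ ())
      (≈-trans (≈-sym (next-≈ ≈-refl)) (≈-reflexive eq))

    prev≢self : ∀ x → prev x ≢ x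
    prev≢self x eq =
      offsets-distinct x m₁ 0 m₁<m 0<m (λ m₁≡0 → <⇒≢ (≤-trans (s≤s z≤n) (s≤s⁻¹ m≥5)) (sym m₁≡0))
      (≈-trans (≈-sym (prev-≈m₁ x)) (≈-reflexive eq))

    next≢prev : ∀ x → next x ≢ prev x
    next≢prev x eq =
      offsets-distinct x 1 m₁ 1<m m₁<m (λ 1≡m₁ → <⇒≢ (≤-trans (s≤s (s≤s z≤n)) (s≤s⁻¹ m≥5)) 1≡m₁)
      (≈-trans (≈-sym (next-≈ ≈-refl)) (≈-trans (≈-reflexive eq) (prev-≈m₁ x)))

    rowSum colSum : ℕ → ℕ
    rowSum x = Σ< m (b x)
    colSum y = Σ< m (λ x → b x y)

    common : ℕ → ℕ → ℕ
    common x k = Σ< m (λ y → b x y * b k y)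

    common-self : ∀ x → common x x ≡ rowSum x
    common-self x = Σ<-cong m (λ y _ → b-idem x y)

    rowSum≥1 : ∀ x → x < m → 1 ≤ rowSum x
    rowSum≥1 x x<m = subst (_≤ rowSum x) (b-true (diagonal x)) (term≤Σ< m (b x) x x<m)

    atLeastOne : ∀ x k y → y < m → B x y ≡ true → B k y ≡ true → 1 ≤ common x k
    atLeastOne x k y y<m Bxy Bky =
      subst (_≤ common x k) (cong₂ _*_ (b-true Bxy) (b-true Bky))
            (term≤Σ< m (λ y → b x y * b k y) y y<m)

    atLeastTwo : ∀ x k u w → ¬ (u ≈ w) → B x u ≡ true → B k u ≡ true → B x w ≡ true → B k w ≡ true →
                 2 ≤ common x k
    atLeastTwo x k u w u≉w Bxu Bku Bxw Bkw =
      subst (_≤ common x k) (cong₂ _+_ (both u Bxu Bku) (both w Bxw Bkw))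
            (twoTerms≤Σ< m (λ y → b x y * b k y) (u % m) (w % m) (m%n<n u m) (m%n<n w m)
                         (λ eq → u≉w (mk≈ eq)))
      where
      both : ∀ y → B x y ≡ true → B k y ≡ true → b x (y % m) * b k (y % m) ≡ 1
      both y Bxy Bky = cong₂ _*_ (trans (b-cong ≈-refl (%-≈ y)) (b-true Bxy))
                                 (trans (b-cong ≈-refl (%-≈ y)) (b-true Bky))

    -- The number of common neighbours that the Φ_m pattern forces, when row x
    -- has a + 1 entries.
    profile : ℕ → ℕ → ℕ → ℕ
    profile a x k = 1 + δ (next x) k + δ (prev x) k + a * δ x k

    profile-self : ∀ a x → profile a x x ≡ 1 + a
    profile-self a x
      rewrite δ-diff (next≢self x) | δ-diff (prev≢self x) | δ-same x | *-identityʳ a = refl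

    profile-next : ∀ a x → profile a x (next x) ≡ 2
    profile-next a x
      rewrite δ-same (next x) | δ-diff (next≢prev x ∘ sym) | δ-diff (next≢self x ∘ sym) | *-zeroʳ a = refl

    profile-prev : ∀ a x → profile a x (prev x) ≡ 2
    profile-prev a x
      rewrite δ-diff (next≢prev x) | δ-same (prev x) | δ-diff (prev≢self x ∘ sym) | *-zeroʳ a = refl

    profile-other : ∀ a x k → k ≢ x → k ≢ next x → k ≢ prev x → profile a x k ≡ 1
    profile-other a x k k≢x k≢next k≢prev
      rewrite δ-diff (k≢next ∘ sym) | δ-diff (k≢prev ∘ sym) | δ-diff (k≢x ∘ sym) | *-zeroʳ a = refl

    profile≤common : ∀ x k → x < m → k < m → profile (rowSum x ∸ 1) x k ≤ common x k
    profile≤common x k x<m k<m with k ≟ x | k ≟ next x | k ≟ prev x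
    ... | yes refl | _ | _ = ≤-reflexive (begin
      profile (rowSum x ∸ 1) x x ≡⟨ profile-self (rowSum x ∸ 1) x ⟩
      1 + (rowSum x ∸ 1)         ≡⟨ m+[n∸m]≡n (rowSum≥1 x x<m) ⟩
      rowSum x                   ≡⟨ common-self x ⟨
      common x x                 ∎)
      where open ≡-Reasoning
    ... | no _ | yes refl | _ = subst (_≤ common x k) (sym (profile-next (rowSum x ∸ 1) x))
      (atLeastTwo x k x k (λ eq → next≢self x (≈⇒≡ (next<m x) x<m (≈-sym eq)))
                  (diagonal x) (next-row x) (next-col x) (diagonal k))
    ... | no _ | no _ | yes refl = subst (_≤ common x k) (sym (profile-prev (rowSum x ∸ 1) x))
      (atLeastTwo x k x k (λ eq → prev≢self x (≈⇒≡ (prev<m x) x<m (≈-sym eq)))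
                  (diagonal x) (prev-row x) (prev-col x) (diagonal k))
    ... | no k≢x | no k≢next | no k≢prev
      with y , y<m , Bxy , Bky ← rowsMeet x k x<m k<m (k≢x ∘ sym)
      = subst (_≤ common x k) (sym (profile-other (rowSum x ∸ 1) x k k≢x k≢next k≢prev))
              (atLeastOne x k y y<m Bxy Bky)

    Σ-profile : ∀ a x → x < m → Σ< m (profile a x) ≡ m + 1 + 1 + a
    Σ-profile a x x<m = begin
      Σ< m (profile a x)                   ≡⟨ Σ<-cong m (λ k _ → *-identityˡ (profile a x k)) ⟨
      Σ< m (λ k → 1 * profile a x k)       ≡⟨ Σ<-weighted m (λ _ → 1) a (next x) (prev x) x (next<m x) (prev<m x) x<m ⟩
      Σ< m (λ _ → 1) + 1 + 1 + a * 1      ≡⟨ cong₂ (λ n e → n + 1 + 1 + e) (Σ<-count m) (*-identityʳ a) ⟩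
      m + 1 + 1 + a                        ∎
      where open ≡-Reasoning

    -- Double counting the paths x ∼ y ∼ k: at most d per neighbour y of x.
    Σ-common≤ : ∀ x → Σ< m (common x) ≤ d * rowSum x
    Σ-common≤ x = begin
      Σ< m (common x)                            ≡⟨ Σ<-swap m m (λ k y → b x y * b k y) ⟩
      Σ< m (λ y → Σ< m (λ k → b x y * b k y))    ≡⟨ Σ<-cong m (λ y _ → Σ<-*ˡ m (b x y) (λ k → b k y)) ⟩
      Σ< m (λ y → b x y * colSum y)              ≤⟨ Σ<-mono m (λ y y<m → *-monoʳ-≤ (b x y) (colSum≤ y y<m)) ⟩
      Σ< m (λ y → b x y * d)                     ≡⟨ Σ<-cong m (λ y _ → *-comm (b x y) d) ⟩
      Σ< m (λ y → d * b x y)                     ≡⟨ Σ<-*ˡ m d (b x) ⟩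
      d * rowSum x                               ∎
      where open ≤-Reasoning

    rowSum≡d : ∀ x → x < m → rowSum x ≡ d
    rowSum≡d x x<m = degree-forced (rowSum x) (rowSum≤ x x<m) (begin
      m + 1 + rowSum x                  ≡⟨ cong (m + 1 +_) (m+[n∸m]≡n (rowSum≥1 x x<m)) ⟨
      m + 1 + (1 + (rowSum x ∸ 1))      ≡⟨ +-assoc (m + 1) 1 _ ⟨
      m + 1 + 1 + (rowSum x ∸ 1)        ≡⟨ Σ-profile (rowSum x ∸ 1) x x<m ⟨
      Σ< m (profile (rowSum x ∸ 1) x)   ≤⟨ Σ<-mono m (λ k k<m → profile≤common x k x<m k<m) ⟩
      Σ< m (common x)                   ≤⟨ Σ-common≤ x ⟩
      d * rowSum x                      ∎)
      where open ≤-Reasoning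

    -- Hence the lower bound is attained: rows x, k (x ≠ k) share exactly one
    -- neighbour, or two if k = x ± 1.
    common≡profile : ∀ x k → x < m → k < m → common x k ≡ profile d' x k
    common≡profile x k x<m k<m = Σ<-tight m (profile d' x) (common x) bounded sums-equal k k<m
      where
      bounded : ∀ k → k < m → profile d' x k ≤ common x k
      bounded k k<m = subst (λ r → profile (r ∸ 1) x k ≤ common x k) (rowSum≡d x x<m) (profile≤common x k x<m k<m)

      square : m + 1 + 1 + d' ≡ d * d
      square = trans (cong (λ n → n + 1 + d') m+1≡dd') (expand d')
        where
        expand : ∀ e → suc e * e + 1 + e ≡ suc e * suc e
        expand = solve-∀

      sums-equal : Σ< m (common x) ≡ Σ< m (profile d' x)
      sums-equal = ≤-antisym
        (≤-trans (Σ-common≤ x) (≤-reflexive (trans (cong (d *_) (rowSum≡d x x<m))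
                                              (trans (sym square) (sym (Σ-profile d' x x<m))))))
        (Σ<-mono m bounded)

  -- Counting the walks x ∼ · ∼ · ∼ y in two ways shows that B commutes with
  -- next + prev.  A local argument upgrades this to invariance of B under the
  -- simultaneous shift (x, y) ↦ (x + 1, y + 1).
  module Shifts {B : ℕ → ℕ → Bool} (I : IsIncidence B) where

    open IsIncidence I
    open Counting I
    private module Cols = Counting (transpose I)

    B-transport : ∀ {x x' y y'} → x ≈ x' → y ≈ y' → B x' y' ≡ true → B x y ≡ true
    B-transport x≈x' y≈y' = trans (B-cong x≈x' y≈y')

    -- next and prev are mutually inverse on [0, m).
    δ-next-prev : ∀ z y → z < m → y < m → δ (next z) y ≡ δ (prev y) z
    δ-next-prev z y z<m y<m = δ-cong next⇒prev prev⇒next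
      where
      next⇒prev : next z ≡ y → prev y ≡ z
      next⇒prev refl = ≈⇒≡ (prev<m y) z<m (prev-≈ (next-≈ ≈-refl))

      prev⇒next : prev y ≡ z → next z ≡ y
      prev⇒next refl = ≈⇒≡ (next<m z) y<m (≈-trans (next-≈ (%-≈ (y + m₁))) (suc-+m₁ y))

    commute : ∀ x y → x < m → y < m → b x (prev y) + b x (next y) ≡ b (next x) y + b (prev x) y
    commute x y x<m y<m =
      cancel (trans (sym walks-via-columns) walks-via-rows)
      where
      open ≡-Reasoning

      -- W counts the walks x ∼ y_z ∼ x_w ∼ y.
      W : ℕ
      W = Σ< m (λ z → b x z * Cols.common z y)

      walks-via-columns : W ≡ d + b x (prev y) + b x (next y) + d' * b x y
      walks-via-columns = begin
        W ≡⟨ Σ<-cong m (λ z z<m → cong (b x z *_) (trans (Cols.common≡profile z y z<m y<m) (swap z z<m))) ⟩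
        Σ< m (λ z → b x z * (1 + δ (prev y) z + δ (next y) z + d' * δ y z))
          ≡⟨ Σ<-weighted m (b x) d' (prev y) (next y) y (prev<m y) (next<m y) y<m ⟩
        rowSum x + b x (prev y) + b x (next y) + d' * b x y
          ≡⟨ cong (λ r → r + b x (prev y) + b x (next y) + d' * b x y) (rowSum≡d x x<m) ⟩
        d + b x (prev y) + b x (next y) + d' * b x y ∎
        where
        swap : ∀ z → z < m → profile d' z y ≡ 1 + δ (prev y) z + δ (next y) z + d' * δ y z
        swap z z<m = trans
          (cong₂ (λ p q → 1 + p + q + d' * δ z y) (δ-next-prev z y z<m y<m) (sym (δ-next-prev y z y<m z<m)))
          (cong (λ e → 1 + δ (prev y) z + δ (next y) z + d' * e) (δ-cong sym sym))

      walks-via-rows : W ≡ d + b (next x) y + b (prev x) y + d' * b x y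
      walks-via-rows = begin
        W ≡⟨ Σ<-cong m (λ z _ → Σ<-*ˡ m (b x z) (λ w → b w z * b w y)) ⟨
        Σ< m (λ z → Σ< m (λ w → b x z * (b w z * b w y)))
          ≡⟨ Σ<-swap m m (λ z w → b x z * (b w z * b w y)) ⟩
        Σ< m (λ w → Σ< m (λ z → b x z * (b w z * b w y)))
          ≡⟨ Σ<-cong m (λ w _ → Σ<-cong m (λ z _ → rearrange (b x z) (b w z) (b w y))) ⟩
        Σ< m (λ w → Σ< m (λ z → b w y * (b x z * b w z)))
          ≡⟨ Σ<-cong m (λ w w<m → trans (Σ<-*ˡ m (b w y) (λ z → b x z * b w z))
                                         (cong (b w y *_) (common≡profile x w x<m w<m))) ⟩
        Σ< m (λ w → b w y * profile d' x w)
          ≡⟨ Σ<-weighted m (λ w → b w y) d' (next x) (prev x) x (next<m x) (prev<m x) x<m ⟩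
        colSum y + b (next x) y + b (prev x) y + d' * b x y
          ≡⟨ cong (λ c → c + b (next x) y + b (prev x) y + d' * b x y) (Cols.rowSum≡d y y<m) ⟩
        d + b (next x) y + b (prev x) y + d' * b x y ∎
        where
        rearrange : ∀ p q r → p * (q * r) ≡ r * (p * q)
        rearrange = solve-∀

      cancel : ∀ {p q r s} → d + p + q + d' * b x y ≡ d + r + s + d' * b x y → p + q ≡ r + s
      cancel {p} {q} {r} {s} eq =
        +-cancelˡ-≡ d _ _ (trans (sym (+-assoc d p q)) (trans (+-cancelʳ-≡ (d' * b x y) _ _ eq) (+-assoc d r s)))

    commute-ℕ : ∀ i j → b (1 + i) j + b (1 + i) (2 + j) ≡ b i (1 + j) + b (2 + i) (1 + j)
    commute-ℕ i j = begin
      b (1 + i) j + b (1 + i) (2 + j)   ≡⟨ cong₂ _+_ (b-cong x≈ (prev-≈ y≈)) (b-cong x≈ (next-≈ y≈)) ⟨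
      b x (prev y) + b x (next y)       ≡⟨ commute x y (m%n<n (1 + i) m) (m%n<n (1 + j) m) ⟩
      b (next x) y + b (prev x) y       ≡⟨ cong₂ _+_ (b-cong (next-≈ x≈) y≈) (b-cong (prev-≈ x≈) y≈) ⟩
      b (2 + i) (1 + j) + b i (1 + j)   ≡⟨ +-comm (b (2 + i) (1 + j)) (b i (1 + j)) ⟩
      b i (1 + j) + b (2 + i) (1 + j)   ∎
      where
      open ≡-Reasoning
      x y : ℕ
      x = (1 + i) % m
      y = (1 + j) % m
      x≈ : x ≈ 1 + i
      x≈ = %-≈ (1 + i)
      y≈ : y ≈ 1 + j
      y≈ = %-≈ (1 + j)

    -- Rows at cyclic distance t ∉ {0, ±1} share exactly one column, so they
    -- cannot share two different ones.
    noDoubleCommon : ∀ p t u w → 2 ≤ t → 2 + t ≤ m → ¬ (u ≈ w) →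
                     B p u ≡ true → B (t + p) u ≡ true → B p w ≡ true → B (t + p) w ≡ true → ⊥
    noDoubleCommon p t u w 2≤t 2+t≤m u≉w Bpu Btu Bpw Btw = <-irrefl (sym exactlyOne) atLeast2
      where
      x k : ℕ
      x = p % m
      k = (t + p) % m

      t<m₁ : t < m₁
      t<m₁ = s≤s⁻¹ 2+t≤m

      notAt : ∀ s → s < m → t ≢ s → ∀ {r} → r ≈ s + p → k ≢ r
      notAt s s<m t≢s r≈s+p k≡r =
        offsets-distinct p t s (<-trans t<m₁ m₁<m) s<m t≢s
          (≈-trans (≈-sym (%-≈ (t + p))) (≈-trans (≈-reflexive k≡r) r≈s+p))

      exactlyOne : common x k ≡ 1
      exactlyOne = trans (common≡profile x k (m%n<n p m) (m%n<n (t + p) m))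
        (profile-other d' x k
          (notAt 0 0<m (λ t≡0 → <⇒≢ (≤-trans (s≤s z≤n) 2≤t) (sym t≡0)) (%-≈ p))
          (notAt 1 1<m (λ t≡1 → <⇒≢ 2≤t (sym t≡1)) (next-≈ (%-≈ p)))
          (notAt m₁ m₁<m (<⇒≢ t<m₁) (≈-trans (prev-≈m₁ x) (≈-+ (≈-refl {m₁}) (%-≈ p)))))

      atLeast2 : 2 ≤ common x k
      atLeast2 = atLeastTwo x k u w u≉w
        (B-transport (%-≈ p) ≈-refl Bpu) (B-transport (%-≈ (t + p)) ≈-refl Btu)
        (B-transport (%-≈ p) ≈-refl Bpw) (B-transport (%-≈ (t + p)) ≈-refl Btw)

    -- No "staircase": entries at offset f + 2 in row p and at offset f in row
    -- p + 1 cannot coexist.  By the commutation relation such a pair either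
    -- moves one step inwards or produces two rows sharing two columns.
    noStaircase : ∀ f p → 4 + f ≤ m → B p (2 + f + p) ≡ true → B (1 + p) (1 + f + p) ≡ true → ⊥
    noStaircase 0 p 4≤m B-p₂ _ =
      noDoubleCommon p 2 (1 + p) (2 + p) ≤-refl 4≤m (offsets-distinct p 1 2 1<m 2<m (λ ()))
        (upper p) (lower (1 + p)) B-p₂ (diagonal (2 + p))
    noStaircase 1 p 5≤m B-p₃ _ =
      noDoubleCommon p 2 (1 + p) (3 + p) ≤-refl (≤-trans (n≤1+n 4) 5≤m) (offsets-distinct p 1 3 1<m 3<m (λ ()))
        (upper p) (lower (1 + p)) B-p₃ (upper (2 + p))
    noStaircase (suc (suc g)) p 6+g≤m B-p₄ B-p'₃
      with bit-sum (sym (commute-ℕ p (1 + g + p))) (inj₂ B-p'₃)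
    ... | inj₁ B-p₂ =
      noDoubleCommon p (3 + g) (2 + g + p) (4 + g + p) (s≤s (s≤s z≤n)) (≤-trans (n≤1+n (5 + g)) 6+g≤m)
        (offsets-distinct (g + p) 2 4 2<m (≤-trans (s≤s (s≤s (s≤s (s≤s (s≤s z≤n))))) 6+g≤m) (λ ()))
        B-p₂ (lower (2 + g + p)) B-p₄ (upper (3 + g + p))
    ... | inj₂ B-p''₂ =
      noStaircase g (1 + p) (≤-trans (≤-trans (n≤1+n (4 + g)) (n≤1+n (5 + g))) 6+g≤m)
        (subst (λ c → B (1 + p) c ≡ true) (sym (+-suc (2 + g) p)) B-p'₃)
        (subst (λ c → B (2 + p) c ≡ true) (sym (+-suc (1 + g) p)) B-p''₂)

    shift-step : ∀ e x → e < m → B x (e + x) ≡ true → B (1 + x) (1 + e + x) ≡ true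
    shift-step 0 x _ _ = diagonal (1 + x)
    shift-step 1 x _ _ = upper (1 + x)
    shift-step (suc (suc f)) x 2+f<m B-x₂ with 2 + f ≟ m₁
    ... | yes 2+f≡m₁ = B-transport ≈-refl wraps (lower x)
      where
      wraps : 3 + f + x ≈ x
      wraps = ≈-trans (≈-reflexive (trans (cong (λ n → suc n + x) 2+f≡m₁) (+-comm m x))) (+m-≈ x)
    ... | no 2+f≢m₁ with bit-sum (commute-ℕ x (1 + f + x)) (inj₁ B-x₂)
    ...   | inj₁ B-x'₀ = ⊥-elim (noStaircase f x (s≤s (≤∧≢⇒< (s≤s⁻¹ 2+f<m) 2+f≢m₁)) B-x₂ B-x'₀)
    ...   | inj₂ B-x'₂ = B-x'₂

    shift-one : ∀ x y → B x y ≡ true → B (1 + x) (1 + y) ≡ true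
    shift-one x y Bxy =
      B-transport ≈-refl (≈-sym (≈-+ (≈-refl {1}) e+x≈y))
        (shift-step e x (m%n<n (y + (m ∸ x % m)) m) (B-transport ≈-refl e+x≈y Bxy))
      where
      open ≈-Reasoning
      e : ℕ
      e = (y + (m ∸ x % m)) % m

      e+x≈y : e + x ≈ y
      e+x≈y = begin
        e + x                   ≈⟨ ≈-+ (%-≈ (y + (m ∸ x % m))) (≈-refl {x}) ⟩
        y + (m ∸ x % m) + x     ≡⟨ regroup y (m ∸ x % m) x ⟩
        y + (x + (m ∸ x % m))   ≈⟨ ≈-+ (≈-refl {y}) (+-inverse x) ⟩
        y + 0                   ≡⟨ +-identityʳ y ⟩
        y                       ∎
        where
        regroup : ∀ a r c → a + r + c ≡ a + (c + r)
        regroup = solve-∀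

    shiftBy : ∀ s x y → B x y ≡ true → B (s + x) (s + y) ≡ true
    shiftBy zero    x y Bxy = Bxy
    shiftBy (suc s) x y Bxy = shift-one (s + x) (s + y) (shiftBy s x y Bxy)

module FromGraph
  (Γ : Graph) (m₁ d' : ℕ) (m≥5 : 5 ≤ suc m₁) (m+1≡dd' : suc m₁ + 1 ≡ suc d' * d')
  (φ : (Fin (suc m₁) ⊎ Fin (suc m₁)) ⤖ Fin (Graph.n Γ))
  (Φ⇔Γ₁ : ∀ a b → PhiAdj (suc m₁) a b ⇔ EΓ₁ Γ (Bijection.to φ a) (Bijection.to φ b))
  (bipartite : Bipartite Γ)
  (degree≤d : ∀ v → degree Γ v ≤ suc d')
  (diameter≤3 : ∀ u v → ∃ λ k → k ≤ 3 × Walk Γ u v k)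
  where

  open CyclicIncidence m₁ d' m≥5 m+1≡dd'
  open FiniteSums
  open FinSums
  open BipartiteWalks Γ
  open Graph Γ using (n; adj)

  vertex : Fin m ⊎ Fin m → Fin n
  vertex = Bijection.to φ

  preimage : ∀ v → ∃ λ s → vertex s ≡ v
  preimage v = proj₁ (Bijection.surjective φ v) , proj₂ (Bijection.surjective φ v) refl

  X Y : ℕ → Fin n
  X x = vertex (inj₁ (x mod m))
  Y y = vertex (inj₂ (y mod m))

  B : ℕ → ℕ → Bool
  B x y = adj (X x) (Y y)

  toℕ-mod : ∀ x → toℕ (x mod m) ≈ x
  toℕ-mod x = ≈-trans (≈-reflexive (Fin.toℕ-fromℕ< (m%n<n x m))) (%-≈ x)

  mod-cong : ∀ {x x'} → x ≈ x' → x mod m ≡ x' mod m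
  mod-cong {x} {x'} (mk≈ eq) =
    Fin.toℕ-injective (trans (Fin.toℕ-fromℕ< (m%n<n x m)) (trans eq (sym (Fin.toℕ-fromℕ< (m%n<n x' m)))))

  mod-toℕ : ∀ (i : Fin m) → toℕ i mod m ≡ i
  mod-toℕ i = Fin.toℕ-injective (trans (Fin.toℕ-fromℕ< (m%n<n (toℕ i) m)) (m<n⇒m%n≡m (Fin.toℕ<n i)))

  mod-injective : ∀ {x x'} → x < m → x' < m → x mod m ≡ x' mod m → x ≡ x'
  mod-injective {x} {x'} x<m x'<m eq =
    ≈⇒≡ x<m x'<m (≈-trans (≈-sym (toℕ-mod x)) (≈-trans (≈-reflexive (cong toℕ eq)) (toℕ-mod x')))

  X-injective : ∀ a b → a < m → b < m → X a ≡ X b → a ≡ b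
  X-injective a b a<m b<m = mod-injective a<m b<m ∘ inj₁-injective ∘ Bijection.injective φ

  Y-injective : ∀ a b → a < m → b < m → Y a ≡ Y b → a ≡ b
  Y-injective a b a<m b<m = mod-injective a<m b<m ∘ inj₂-injective ∘ Bijection.injective φ

  X-toℕ : ∀ i → X (toℕ i) ≡ vertex (inj₁ i)
  X-toℕ i = cong (vertex ∘ inj₁) (mod-toℕ i)

  Y-toℕ : ∀ j → Y (toℕ j) ≡ vertex (inj₂ j)
  Y-toℕ j = cong (vertex ∘ inj₂) (mod-toℕ j)

  EΓ₁⇒Adj : ∀ {u v} → EΓ₁ Γ u v → Adj Γ u v
  EΓ₁⇒Adj (C , _ , inj₁ (i , inj₁ (refl , refl))) = ShortCycle.steps C i
  EΓ₁⇒Adj (C , _ , inj₁ (i , inj₂ (refl , refl))) = Adj-sym (ShortCycle.steps C i)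
  EΓ₁⇒Adj (C , _ , inj₂ (inj₁ (refl , refl)))     = ShortCycle.close C
  EΓ₁⇒Adj (C , _ , inj₂ (inj₂ (refl , refl)))     = Adj-sym (ShortCycle.close C)

  Φ-edge : ∀ x y → PhiXY m (x mod m) (y mod m) → B x y ≡ true
  Φ-edge x y = EΓ₁⇒Adj ∘ Equivalence.to (Φ⇔Γ₁ (inj₁ (x mod m)) (inj₂ (y mod m)))

  Φ-diagonal : ∀ x → B x x ≡ true
  Φ-diagonal x = Φ-edge x x (inj₁ (Equivalence.from [mod]⇔≈ ≈-refl))

  suc-toℕ-mod : ∀ x → toℕ (suc x mod m) ≈ suc (toℕ (x mod m))
  suc-toℕ-mod x = ≈-trans (toℕ-mod (suc x)) (≈-sym (≈-+ (≈-refl {1}) (toℕ-mod x)))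

  Φ-upper : ∀ x → B x (suc x) ≡ true
  Φ-upper x = Φ-edge x (suc x) (inj₂ (inj₁ (Equivalence.from [mod]⇔≈ (suc-toℕ-mod x))))

  Φ-lower : ∀ x → B (suc x) x ≡ true
  Φ-lower x = Φ-edge (suc x) x (inj₂ (inj₂ (Equivalence.from [mod]⇔≈ (≈-sym (suc-toℕ-mod x)))))

  col : Fin n → Bool
  col = proj₁ bipartite

  proper : ∀ u v → Adj Γ u v → col u ≢ col v
  proper = proj₂ bipartite

  colour-X : ∀ x → col (X x) ≡ col (X 0)
  colour-X zero    = refl
  colour-X (suc x) = trans (two-colours (proper _ _ (Φ-lower x)) (proper _ _ (Φ-diagonal x))) (colour-X x)

  colour-Y : ∀ y → col (Y y) ≢ col (X 0)
  colour-Y y eq = proper _ _ (Φ-diagonal y) (trans (colour-X y) (sym eq))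

  colour-inj₁ : ∀ i → col (vertex (inj₁ i)) ≡ col (X 0)
  colour-inj₁ i = subst (λ v → col v ≡ col (X 0)) (X-toℕ i) (colour-X (toℕ i))

  colour-inj₂ : ∀ j → col (vertex (inj₂ j)) ≢ col (X 0)
  colour-inj₂ j = subst (λ v → col v ≢ col (X 0)) (Y-toℕ j) (colour-Y (toℕ j))

  rowsMeet : ∀ x k → x < m → k < m → x ≢ k → ∃ λ y → y < m × B x y ≡ true × B k y ≡ true
  rowsMeet x k x<m k<m x≢k with diameter≤3 (X x) (X k)
  ... | _ , ℓ≤3 , walk with walk≤3 col proper ℓ≤3 walk (trans (colour-X x) (sym (colour-X k)))
  ... | inj₁ Xx≡Xk = ⊥-elim (x≢k (X-injective x k x<m k<m Xx≡Xk))
  ... | inj₂ (u , x∼u , u∼k) with preimage u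
  ... | inj₁ i , refl = ⊥-elim (proper _ _ x∼u (trans (colour-X x) (sym (colour-inj₁ i))))
  ... | inj₂ j , refl = toℕ j , Fin.toℕ<n j ,
    subst (λ v → adj (X x) v ≡ true) (sym (Y-toℕ j)) x∼u ,
    subst (λ v → adj (X k) v ≡ true) (sym (Y-toℕ j)) (Adj-sym u∼k)

  colsMeet : ∀ y l → y < m → l < m → y ≢ l → ∃ λ x → x < m × B x y ≡ true × B x l ≡ true
  colsMeet y l y<m l<m y≢l with diameter≤3 (Y y) (Y l)
  ... | _ , ℓ≤3 , walk with walk≤3 col proper ℓ≤3 walk (two-colours (colour-Y y) (colour-Y l))
  ... | inj₁ Yy≡Yl = ⊥-elim (y≢l (Y-injective y l y<m l<m Yy≡Yl))
  ... | inj₂ (u , y∼u , u∼l) with preimage u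
  ... | inj₂ j , refl = ⊥-elim (proper _ _ y∼u (two-colours (colour-Y y) (colour-inj₂ j)))
  ... | inj₁ i , refl = toℕ i , Fin.toℕ<n i ,
    subst (λ v → adj v (Y y) ≡ true) (sym (X-toℕ i)) (Adj-sym y∼u) ,
    subst (λ v → adj v (Y l) ≡ true) (sym (X-toℕ i)) u∼l

  rowSum≤ : ∀ x → x < m → Σ< m (λ y → bit (B x y)) ≤ d
  rowSum≤ x _ = begin
    Σ< m (λ y → bit (adj (X x) (Y y)))   ≤⟨ Σ<-injection≤ m (λ v → bit (adj (X x) v)) Y Y-injective ⟩
    ΣFin n (λ v → bit (adj (X x) v))     ≡⟨ degree≡ΣFin Γ (X x) ⟨
    degree Γ (X x)                       ≤⟨ degree≤d (X x) ⟩
    d                                    ∎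
    where open ≤-Reasoning

  colSum≤ : ∀ y → y < m → Σ< m (λ x → bit (B x y)) ≤ d
  colSum≤ y _ = begin
    Σ< m (λ x → bit (adj (X x) (Y y)))   ≡⟨ Σ<-cong m (λ x _ → cong bit (Graph.sym Γ (X x) (Y y))) ⟩
    Σ< m (λ x → bit (adj (Y y) (X x)))   ≤⟨ Σ<-injection≤ m (λ v → bit (adj (Y y) v)) X X-injective ⟩
    ΣFin n (λ v → bit (adj (Y y) v))     ≡⟨ degree≡ΣFin Γ (Y y) ⟨
    degree Γ (Y y)                       ≤⟨ degree≤d (Y y) ⟩
    d                                    ∎
    where open ≤-Reasoning

  incidence : IsIncidence B
  incidence = record
    { B-cong   = λ x≈x' y≈y' →
        cong₂ (λ i j → adj (vertex (inj₁ i)) (vertex (inj₂ j))) (mod-cong x≈x') (mod-cong y≈y')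
    ; diagonal = Φ-diagonal
    ; upper    = Φ-upper
    ; lower    = Φ-lower
    ; rowSum≤  = rowSum≤
    ; colSum≤  = colSum≤
    ; rowsMeet = rowsMeet
    ; colsMeet = colsMeet
    }

  open Shifts incidence

  row-shift : ∀ i y → i < m → B i y ≡ true ⇔ B 0 ((m ∸ i) + y) ≡ true
  row-shift i y i<m = mk⇔
    (λ Biy → B-transport (≈-sym m∸i+i≈0) (≈-refl {(m ∸ i) + y}) (shiftBy (m ∸ i) i y Biy))
    (λ B0T → B-transport (≈-reflexive (sym (+-identityʳ i))) (≈-sym i+T≈y) (shiftBy i 0 ((m ∸ i) + y) B0T))
    where
    m∸i+i≈0 : (m ∸ i) + i ≈ 0
    m∸i+i≈0 = ≈-trans (≈-reflexive (m∸n+n≡m (<⇒≤ i<m))) (+m-≈ 0)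

    i+T≈y : i + ((m ∸ i) + y) ≈ y
    i+T≈y = ≈-trans (≈-reflexive (trans (sym (+-assoc i (m ∸ i) y)) (cong (_+ y) (m+[n∸m]≡n (<⇒≤ i<m)))))
                    (≈-trans (≈-reflexive (+-comm m y)) (+m-≈ y))

  module Neighbourhoods
    (offs : Fin (d ∸ 3) → ℕ)
    (nbrs₀ : ∀ (i : Fin m) → toℕ i ≡ 0 → ∀ v →
               Adj Γ (vertex (inj₁ i)) v ⇔ (∃ λ j → v ≡ vertex (inj₂ j) × NbrPattern m d offs 0 j))
    where

    open PatternTranslation m d offs

    Pattern : ℕ → Fin m → Set
    Pattern = NbrPattern m d offs

    row₀ : ∀ T → B 0 T ≡ true ⇔ Pattern 0 (T mod m)
    row₀ T = mk⇔ to from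
      where
      to : B 0 T ≡ true → Pattern 0 (T mod m)
      to B0T with j , YT≡yj , pattern-j ← Equivalence.to (nbrs₀ (0 mod m) refl (Y T)) B0T =
        subst (Pattern 0) (sym (inj₂-injective (Bijection.injective φ YT≡yj))) pattern-j

      from : Pattern 0 (T mod m) → B 0 T ≡ true
      from pattern-T = Equivalence.from (nbrs₀ (0 mod m) refl (Y T)) (T mod m , refl , pattern-T)

    -- x_k ∼ y_j iff j lies in the pattern of x_k: B (toℕ k) (toℕ j) reduces to
    -- row 0 at column T = (m - k) + j, whose pattern translates back by k.
    entry⇔pattern : ∀ k j → Adj Γ (vertex (inj₁ k)) (vertex (inj₂ j)) ⇔ Pattern (toℕ k) j
    entry⇔pattern k j =
      ⇔.trans (mk⇔ (trans entry) (trans (sym entry)))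
     (⇔.trans (row-shift i (toℕ j) i<m)
     (⇔.trans (row₀ T)
              (NbrPattern-translate i column≈)))
      where
      i T : ℕ
      i = toℕ k
      T = (m ∸ i) + toℕ j

      i<m : i < m
      i<m = Fin.toℕ<n k

      entry : B i (toℕ j) ≡ adj (vertex (inj₁ k)) (vertex (inj₂ j))
      entry = cong₂ adj (X-toℕ k) (Y-toℕ j)

      column≈ : toℕ j ≈ toℕ (T mod m) + i
      column≈ = ≈-sym (begin
        toℕ (T mod m) + i            ≈⟨ ≈-+ (toℕ-mod T) (≈-refl {i}) ⟩
        (m ∸ i) + toℕ j + i          ≡⟨ regroup (m ∸ i) (toℕ j) i ⟩
        toℕ j + ((m ∸ i) + i)        ≡⟨ cong (toℕ j +_) (m∸n+n≡m (<⇒≤ i<m)) ⟩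
        toℕ j + m                    ≈⟨ +m-≈ (toℕ j) ⟩
        toℕ j                        ∎)
        where
        open ≈-Reasoning
        regroup : ∀ a b c → a + b + c ≡ b + (a + c)
        regroup = solve-∀

    neighbourhood : ∀ k v → Adj Γ (vertex (inj₁ k)) v ⇔ (∃ λ j → v ≡ vertex (inj₂ j) × Pattern (toℕ k) j)
    neighbourhood k v = mk⇔ to from
      where
      to : Adj Γ (vertex (inj₁ k)) v → ∃ λ j → v ≡ vertex (inj₂ j) × Pattern (toℕ k) j
      to xk∼v with preimage v
      ... | inj₁ i , refl = ⊥-elim (proper _ _ xk∼v (trans (colour-inj₁ k) (sym (colour-inj₁ i))))
      ... | inj₂ j , refl = j , refl , Equivalence.to (entry⇔pattern k j) xk∼v

      from : (∃ λ j → v ≡ vertex (inj₂ j) × Pattern (toℕ k) j) → Adj Γ (vertex (inj₁ k)) v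
      from (j , refl , pattern-j) = Equivalence.from (entry⇔pattern k j) pattern-j

module Order (d' : ℕ) (3≤d : 3 ≤ suc d') where

  d²-d : suc d' * suc d' ∸ suc d' ≡ suc d' * d'
  d²-d = trans (cong (_∸ suc d') (*-suc (suc d') d')) (m+n∸m≡n (suc d') (suc d' * d'))

  6≤dd' : 6 ≤ suc d' * d'
  6≤dd' = *-mono-≤ {3} {suc d'} {2} {d'} 3≤d (s≤s⁻¹ 3≤d)

  m≥5 : 5 ≤ suc d' * suc d' ∸ suc d' ∸ 1
  m≥5 = subst (λ e → 5 ≤ e ∸ 1) (sym d²-d) (∸-monoˡ-≤ 1 6≤dd')

  m+1≡dd' : suc d' * suc d' ∸ suc d' ∸ 1 + 1 ≡ suc d' * d'
  m+1≡dd' = trans (cong (λ e → e ∸ 1 + 1) d²-d) (m∸n+n≡m (≤-trans (s≤s z≤n) 6≤dd'))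

corollary5p1 : (d : ℕ) → 3 ≤ d → (Γ : Graph) → BipartiteDDε Γ d 3 4
    → (∀ v → VΓ₁ Γ v)
    → (∀ u v → ∃ λ k → WalkIn Γ (EΓ₁ Γ) u v k)
    → (φ : (Fin (d * d ∸ d ∸ 1) ⊎ Fin (d * d ∸ d ∸ 1)) ⤖ Fin (Graph.n Γ))
    → (∀ a b → PhiAdj (d * d ∸ d ∸ 1) a b ⇔ EΓ₁ Γ (Bijection.to φ a) (Bijection.to φ b))
    → (offs : Fin (d ∸ 3) → ℕ)
    → (∀ (i : Fin (d * d ∸ d ∸ 1)) → toℕ i ≡ 0 → ∀ v →
         Adj Γ (Bijection.to φ (inj₁ i)) v
           ⇔ (∃ λ j → v ≡ Bijection.to φ (inj₂ j) × NbrPattern (d * d ∸ d ∸ 1) d offs 0 j))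
    → ∀ (k : Fin (d * d ∸ d ∸ 1)) → ∀ v →
         Adj Γ (Bijection.to φ (inj₁ k)) v
           ⇔ (∃ λ j → v ≡ Bijection.to φ (inj₂ j) × NbrPattern (d * d ∸ d ∸ 1) d offs (toℕ k) j)
-- Writing m = d² - d - 1 as m₁ + 1 (possible as m ≥ 5), the statement is
-- FromGraph.Neighbourhoods.neighbourhood.
corollary5p1 (suc d') 3≤d Γ (bipartite , (degree≤d , _) , (diameter≤3 , _) , _) _ _ φ Φ⇔Γ₁ offs nbrs₀
  with suc d' * suc d' ∸ suc d' ∸ 1 | Order.m≥5 d' 3≤d | Order.m+1≡dd' d' 3≤d
... | suc m₁ | m≥5 | m+1≡dd' =
  FromGraph.Neighbourhoods.neighbourhood Γ m₁ d' m≥5 m+1≡dd' φ Φ⇔Γ₁ bipartite degree≤d diameter≤3 offs nbrs₀
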